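{- Let $T$ be a left-linear infinitary term rewriting system and $\psi$ a convergent proof term over $T$. Then (a) $tgt(\psi)$ is defined; and (b) for every $n<\omega$, if $mind(\psi)>n$ then $d(src(\psi),tgt(\psi))<2^{ -n}$.
   Context: Terms over a finite signature $\Sigma$ and countable variable set: finite or infinite trees (nonempty prefix-closed position sets, arity-respecting labels). $d(t,u)=0$ if $t=u$, else $2^{ -k}$ with $k$ the least length of a position where they differ; limits w.r.t. $d$. TRS: left-linear rules $\mu:l\to r$ ($l$ finite non-variable), $l=l[x_1..x_n]$, $r=r[x_1..x_n]$; rule symbol $\mu$ of arity $n$. Multisteps: closed finite/infinite terms over $\Sigma$ and rule symbols; $src(\psi)$ normal form under $\mu(\vec x)\to l[\vec x]$; $\psi$ convergent iff it reaches a rule-symbol-free normal form under $\mu(\vec x)\to r[\vec x]$ via a strongly convergent reduction, $tgt(\psi)$ being that form (otherwise undefined); $mind(\psi)$ minimal depth of a rule symbol ($\omega$ if none). Proof terms: least set of closed terms over $\Sigma$, rule symbols, binary $\cdot$, with $src$, partial $tgt$, convergence, $mind$: (1) multisteps; (2) for convergent $\psi_i$ ($i<\omega$) with $tgt\psi_i=src\psi_{i+1}$, $\cdot_{i<\omega}\psi_i=\psi_0\cdot(\psi_1\cdot\cdots)$ with $src=src\psi_0$, $tgt=\lim_i tgt\psi_i$ (undefined if no limit), $mind=\min mind\psi_i$, convergent iff for all $k$ there is $n$ with $mind\psi_j>k$ for all $j>n$; (3) $\psi_1\cdot\psi_2$ for convergent $\psi_1$ with $tgt\psi_1=src\psi_2$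 (infinite concatenation if $\psi_2$ is; else $src=src\psi_1$, $tgt=tgt\psi_2$, $mind=\min$, convergent iff $\psi_2$ is); (4) for proof terms not all multisteps: $f(\psi_1..\psi_n)$ with $src=f(src\psi_i)$, $tgt=f(tgt\psi_i)$, $mind=1+\min$, convergent iff all are; $\mu(\psi_1..\psi_n)$ with $src=l[src\psi_i]$, $tgt=r[tgt\psi_i]$, $mind=0$, convergent iff $\psi_i$ convergent for every $x_i$ occurring in $r$. -}

module Defs where

open import Data.Nat using (ℕ; zero; suc; _≤_; _<_; _<?_; _+_; _≟_)
open import Data.Fin as Fin using (Fin; fromℕ<; toℕ)
open import Data.List using (List; []; _∷_; length; _++_; _∷ʳ_)
open import Data.Maybe using (Maybe; just; nothing) renaming (map to mapMaybe)
open import Data.Sum using (_⊎_; inj₁; inj₂)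
open import Data.Product using (Σ; Σ-syntax; _×_; _,_; ∃; ∃-syntax)
open import Data.Unit using (⊤)
open import Data.Empty using (⊥)
open import Relation.Nullary using (¬_; yes; no)
open import Relation.Binary.PropositionalEquality using (_≡_)
open import Function.Bundles using (_↔_)

-- Finite or infinite trees, represented by their labelling function on
-- positions.  A position is a list of argument indices read from the
-- root (root = []); 'nothing' means "not a position of the tree".

Pos : Set
Pos = List ℕ

RTm : Set → Set
RTm A = Pos → Maybe A

record IsTree {A : Set} (ar : A → ℕ) (t : RTm A) : Set where
  field
    root-def  : ∃[ a ] (t [] ≡ just a)
    closed    : ∀ p i → t p ≡ nothing → t (p ∷ʳ i) ≡ nothing
    arity-in  : ∀ p i a → t p ≡ just a → i < ar a → ∃[ b ] (t (p ∷ʳ i) ≡ just b)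
    arity-out : ∀ p i a → t p ≡ just a → ar a ≤ i → t (p ∷ʳ i) ≡ nothing

record Tm (A : Set) (ar : A → ℕ) : Set where
  field
    lab  : RTm A
    tree : IsTree ar lab
open Tm public

module _ {A : Set} where

  shift : RTm A → Pos → RTm A
  shift t p q = t (p ++ q)

  _≈_ : RTm A → RTm A → Set
  t ≈ u = ∀ p → t p ≡ u p

  -- d(t,u) < 2^(-n): t = u, or the least length of a position where they
  -- differ is > n; i.e. they agree on all positions of length ≤ n.
  DistLt : ℕ → RTm A → RTm A → Set
  DistLt n t u = ∀ p → length p ≤ n → t p ≡ u p

  Lim : (ℕ → RTm A) → RTm A → Set
  Lim ts t = ∀ n → ∃[ N ] (∀ i → N ≤ i → DistLt n (ts i) t)

  replace : RTm A → Pos → RTm A → RTm A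
  replace t []      c q       = c q
  replace t (i ∷ p) c []      = t []
  replace t (i ∷ p) c (j ∷ q) with i ≟ j
  ... | yes _ = replace (shift t (i ∷ [])) p c q
  ... | no _  = t (j ∷ q)

idx : (k : ℕ) → ℕ → Maybe (Fin k)
idx k i with i <? k
... | yes p = just (fromℕ< p)
... | no _  = nothing

record Signature : Set₁ where
  field
    Sym    : Set
    ar     : Sym → ℕ
    finite : ∃[ m ] (Sym ↔ Fin m)

module _ (S : Signature) where
  open Signature S

  data FTerm (n : ℕ) : Set where
    var : Fin n → FTerm n
    fun : (f : Sym) → (Fin (ar f) → FTerm n) → FTerm n

  sumFin : (k : ℕ) → (Fin k → ℕ) → ℕ
  sumFin zero    g = 0
  sumFin (suc k) g = g Fin.zero + sumFin k (λ j → g (Fin.suc j))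

  occ : ∀ {n} → Fin n → FTerm n → ℕ
  occ x (var y) with x Fin.≟ y
  ... | yes _ = 1
  ... | no _  = 0
  occ x (fun f ts) = sumFin (ar f) (λ j → occ x (ts j))

  data Occurs {n : ℕ} (x : Fin n) : FTerm n → Set where
    here  : Occurs x (var x)
    under : ∀ {f ts} (j : Fin (ar f)) → Occurs x (ts j) → Occurs x (fun f ts)

  -- a left-linear rule  mu : l[x_1..x_n] → r[x_1..x_n],  l non-variable,
  -- each x_i occurring exactly once in l.  Rule symbol mu has arity n.
  record Rule : Set where
    field
      arity       : ℕ
      lsym        : Sym
      largs       : Fin (ar lsym) → FTerm arity
      rhs         : FTerm arity
      left-linear : ∀ i → occ i (fun lsym largs) ≡ 1
    lhs : FTerm arity
    lhs = fun lsym largs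

  record TRS : Set₁ where
    field
      Rl   : Set
      rule : Rl → Rule

  STm : Set
  STm = Tm Sym ar

  mkS : {A : Set} → (Sym → A) → (f : Sym) → (Fin (ar f) → RTm A) → RTm A
  mkS e f ts []      = just (e f)
  mkS e f ts (i ∷ q) with idx (ar f) i
  ... | just j  = ts j q
  ... | nothing = nothing

  inst : {A : Set} → (Sym → A) → ∀ {n} → FTerm n → (Fin n → RTm A) → RTm A
  inst e (var k)    σ q       = σ k q
  inst e (fun f ts) σ []      = just (e f)
  inst e (fun f ts) σ (i ∷ q) with idx (ar f) i
  ... | just j  = inst e (ts j) σ q
  ... | nothing = nothing

  module _ (T : TRS) where
    open TRS T

    Lab : Set
    Lab = Sym ⊎ Rl

    arM : Lab → ℕ
    arM (inj₁ f) = ar f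
    arM (inj₂ μ) = Rule.arity (rule μ)

    -- multisteps: closed finite/infinite terms over Σ and rule symbols
    MTm : Set
    MTm = Tm Lab arM

    emb : RTm Sym → RTm Lab
    emb t q = mapMaybe inj₁ (t q)

    -- one step of the system  mu(x_1..x_n) → r[x_1..x_n]  at position p
    Step : Pos → RTm Lab → RTm Lab → Set
    Step p t u = ∃[ μ ] (t p ≡ just (inj₂ μ)
                 × u ≈ replace t p (inst inj₁ (Rule.rhs (rule μ)) (λ k → shift t (p ∷ʳ toℕ k))))

    -- SC k t u : strongly convergent reduction t ↠ u (of countable ordinal
    -- length) under mu(x) → r[x], all of whose steps are at depth ≥ k.
    data SC (k : ℕ) : RTm Lab → RTm Lab → Set where
      nil  : ∀ {t u} → t ≈ u → SC k t u
      step : ∀ {t u} (p : Pos) → k ≤ length p → Step p t u → SC k t u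
      cat  : ∀ {t u v} → SC k t u → SC k u v → SC k t v
      lim  : ∀ {u} (ts : ℕ → RTm Lab) (ds : ℕ → ℕ)
           → (∀ i → k ≤ ds i)
           → (∀ i → SC (ds i) (ts i) (ts (suc i)))
           → (∀ m → ∃[ N ] (∀ i → N ≤ i → m ≤ ds i))
           → Lim ts u
           → SC k (ts 0) u

    MTgt : MTm → STm → Set
    MTgt ψ t = ∃[ u ] (SC 0 (lab ψ) u × u ≈ emb (lab t))

    -- source of a multistep: normal form under mu(x) → l[x], computed
    -- position by position.  State: at position q of ψ, or inside the
    -- left-hand side of a rule symbol whose arguments sit at positions σ.
    data SrcSt : Set where
      at  : Pos → SrcSt
      inl : ∀ {n} → FTerm n → (Fin n → Pos) → SrcSt

    module _ (ψ : RTm Lab) where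
      srcAt : SrcSt → Pos → Maybe Sym
      srcLab : Maybe Lab → Pos → Pos → Maybe Sym
      srcLab nothing         q p = nothing
      srcLab (just (inj₁ f)) q [] = just f
      srcLab (just (inj₁ f)) q (i ∷ p) = srcAt (at (q ∷ʳ i)) p
      srcLab (just (inj₂ μ)) q [] = just (Rule.lsym (rule μ))
      srcLab (just (inj₂ μ)) q (i ∷ p) with idx (ar (Rule.lsym (rule μ))) i
      ... | just j  = srcAt (inl (Rule.largs (rule μ) j) (λ k → q ∷ʳ toℕ k)) p
      ... | nothing = nothing
      srcAt (at q) p = srcLab (ψ q) q p
      srcAt (inl (var k) σ) p = srcLab (ψ (σ k)) (σ k) p
      srcAt (inl (fun f ts) σ) [] = just f
      srcAt (inl (fun f ts) σ) (i ∷ p) with idx (ar f) i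
      ... | just j  = srcAt (inl (ts j) σ) p
      ... | nothing = nothing

    msrc : MTm → RTm Sym
    msrc ψ = srcAt (lab ψ) (at [])

    data PT : Set where
      msP  : MTm → PT
      icat : (ℕ → PT) → PT
      _·_  : PT → PT → PT
      fnP  : (f : Sym) → (Fin (ar f) → PT) → PT
      rlP  : (μ : Rl) → (Fin (Rule.arity (rule μ)) → PT) → PT

    IsMS : PT → Set
    IsMS (msP _) = ⊤
    IsMS _       = ⊥

    src : PT → RTm Sym
    src (msP ψ)    = msrc ψ
    src (icat ψs)  = src (ψs 0)
    src (ψ₁ · ψ₂)  = src ψ₁
    src (fnP f ψs) = mkS (λ g → g) f (λ j → src (ψs j))
    src (rlP μ ψs) = inst (λ g → g) (Rule.lhs (rule μ)) (λ j → src (ψs j))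

    -- Tgt ψ t : tgt(ψ) is defined and equals t
    Tgt : PT → STm → Set
    Tgt (msP ψ)    t = MTgt ψ t
    Tgt (icat ψs)  t = Σ[ ts ∈ (ℕ → STm) ] ((∀ i → Tgt (ψs i) (ts i)) × Lim (λ i → lab (ts i)) (lab t))
    Tgt (ψ₁ · ψ₂)  t = Tgt ψ₂ t
    Tgt (fnP f ψs) t = Σ[ ts ∈ (Fin (ar f) → STm) ] ((∀ j → Tgt (ψs j) (ts j))
                                × lab t ≈ mkS (λ g → g) f (λ j → lab (ts j)))
    Tgt (rlP μ ψs) t = Σ[ ts ∈ (Fin (Rule.arity (rule μ)) → STm) ] ((∀ j → Occurs j (Rule.rhs (rule μ)) → Tgt (ψs j) (ts j))
                                × lab t ≈ inst (λ g → g) (Rule.rhs (rule μ)) (λ j → lab (ts j)))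

    -- MindGt n ψ :  mind(ψ) > n
    MindGt : ℕ → PT → Set
    MindGt n (msP ψ) = ∀ p → length p ≤ n → ∀ μ → ¬ (lab ψ p ≡ just (inj₂ μ))
    MindGt n (icat ψs) = ∀ i → MindGt n (ψs i)
    MindGt n (ψ₁ · ψ₂) = MindGt n ψ₁ × MindGt n ψ₂
    MindGt zero (fnP f ψs) = ⊤
    MindGt (suc n) (fnP f ψs) = ∀ j → MindGt n (ψs j)
    MindGt n (rlP μ ψs) = ⊥

    Conv : PT → Set
    Conv (msP ψ)    = ∃[ t ] MTgt ψ t
    Conv (icat ψs)  = ∀ k → ∃[ n ] (∀ j → n < j → MindGt k (ψs j))
    Conv (ψ₁ · ψ₂)  = Conv ψ₂
    Conv (fnP f ψs) = ∀ j → Conv (ψs j)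
    Conv (rlP μ ψs) = ∀ j → Occurs j (Rule.rhs (rule μ)) → Conv (ψs j)

    WF : PT → Set
    WF (msP ψ)    = ⊤
    WF (icat ψs)  = ∀ i → WF (ψs i) × Conv (ψs i) × (∃[ t ] (Tgt (ψs i) t × lab t ≈ src (ψs (suc i))))
    WF (ψ₁ · ψ₂)  = WF ψ₁ × WF ψ₂ × Conv ψ₁ × (∃[ t ] (Tgt ψ₁ t × lab t ≈ src ψ₂))
    WF (fnP f ψs) = (∀ j → WF (ψs j)) × ¬ (∀ j → IsMS (ψs j))
    WF (rlP μ ψs) = (∀ j → WF (ψs j)) × ¬ (∀ j → IsMS (ψs j))

{-# OPTIONS --safe #-}
-- Part (b) holds by induction on ψ, independently of (a). In a multistep without rule
-- symbols at depth ≤ n, every step of a strongly convergent reduction contracts a rule symbol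
-- and hence happens below depth n, so the top n levels survive into the target; the source
-- reads off the same symbols there. Concatenations chain these approximations along matching
-- sources and targets, and an infinite concatenation passes to the limit. For (a) every
-- constructor builds its target directly except the infinite concatenation: by (b) and
-- convergence, consecutive targets eventually agree up to any depth, and such a Cauchy
-- sequence of trees has a limit, read off position by position.
module Submission where

open import Defs
open import Data.Nat using (ℕ; zero; suc; _≤_; _<_; _<?_; _≤?_; _⊔_; s≤s; _≤′_; ≤′-reflexive; ≤′-step; _≟_)
open import Data.Nat.Properties
  using (≤-refl; ≤-trans; ≤-reflexive; <-≤-trans; ≤-<-trans; m≤m+n; m≤m⊔n; m≤n⊔m; ≤⇒≤′; ≤′⇒≤; ≤⇒≯; ≰⇒>; m<n⇒m<1+n)
open import Data.Fin as Fin using (Fin; fromℕ<)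
open import Data.Fin.Properties using (any?)
open import Data.List using ([]; _∷_; length; _++_; _∷ʳ_)
open import Data.List.Properties using (++-assoc; ++-identityʳ; length-++)
open import Data.Maybe using (just; nothing)
open import Data.Maybe.Properties using (map-injective)
open import Data.Sum using (inj₁; inj₂)
open import Data.Sum.Properties using (inj₁-injective)
open import Data.Product using (_×_; _,_; ∃-syntax; proj₁; proj₂; map₂)
open import Data.Empty using (⊥-elim)
open import Function using (_∘_; const)
open import Relation.Nullary using (¬_; yes; no; Dec)
open import Relation.Binary.Bundles using (Setoid)
open import Relation.Binary.Structures using (IsEquivalence)
open import Relation.Binary.PropositionalEquality using (_≡_; refl; sym; trans; cong; subst)
import Relation.Binary.Reasoning.Setoid as SetoidReasoning

length-≤-++ : ∀ (p q : Pos) → length p ≤ length (p ++ q)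
length-≤-++ p q = ≤-trans (m≤m+n (length p) (length q)) (≤-reflexive (sym (length-++ p)))

replace-above : ∀ {A : Set} (t : RTm A) p c q → length q < length p → replace t p c q ≡ t q
replace-above t (i ∷ p) c []      _        = refl
replace-above t (i ∷ p) c (j ∷ q) (s≤s lt) with i ≟ j
... | yes refl = replace-above (shift t (i ∷ [])) p c q lt
... | no _     = refl

idx-< : ∀ {k i} → i < k → ∃[ j ] (idx k i ≡ just j)
idx-< {k} {i} lt with i <? k
... | yes p = fromℕ< p , refl
... | no ¬p = ⊥-elim (¬p lt)

idx-≥ : ∀ {k i} → k ≤ i → idx k i ≡ nothing
idx-≥ {k} {i} ge with i <? k
... | yes p = ⊥-elim (≤⇒≯ ge p)
... | no _  = refl

module _ {A : Set} where

  ≈⇒DistLt : ∀ {n} {t u : RTm A} → t ≈ u → DistLt n t u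
  ≈⇒DistLt t≈u p _ = t≈u p

  DistLt-isEquivalence : ∀ n → IsEquivalence (DistLt {A} n)
  DistLt-isEquivalence n = record
    { refl  = λ p _ → refl
    ; sym   = λ t≈u p lp → sym (t≈u p lp)
    ; trans = λ t≈u u≈v p lp → trans (t≈u p lp) (u≈v p lp)
    }

  DistLt-setoid : ℕ → Setoid _ _
  DistLt-setoid n = record { isEquivalence = DistLt-isEquivalence n }

  module DistLt-Reasoning (n : ℕ) = SetoidReasoning (DistLt-setoid n)

  module _ {n : ℕ} where
    open IsEquivalence (DistLt-isEquivalence n) public
      renaming (refl to DistLt-refl; sym to DistLt-sym; trans to DistLt-trans)

  -- In the ultrametric d, closeness of consecutive terms suffices.
  Cauchy : (ℕ → RTm A) → Set
  Cauchy ts = ∀ k → ∃[ N ] (∀ j → N < j → DistLt k (ts j) (ts (suc j)))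

module _ {A : Set} {ar : A → ℕ} where

  closed-++ : ∀ {t : RTm A} → IsTree ar t → ∀ p q → t p ≡ nothing → t (p ++ q) ≡ nothing
  closed-++ {t} tr p []      tp = subst (λ r → t r ≡ nothing) (sym (++-identityʳ p)) tp
  closed-++ {t} tr p (i ∷ q) tp =
    subst (λ r → t r ≡ nothing) (++-assoc p (i ∷ []) q) (closed-++ tr (p ∷ʳ i) q (IsTree.closed tr p i tp))

  module _ (a : A) where

    constLab : RTm A
    constLab []      = just a
    constLab (i ∷ p) with i <? ar a
    ... | yes _ = constLab p
    ... | no _  = nothing

    private
      closed : ∀ p i → constLab p ≡ nothing → constLab (p ∷ʳ i) ≡ nothing
      closed (j ∷ p) i e with j <? ar a
      ... | yes _ = closed p i e
      ... | no _  = refl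

      arity-in : ∀ p i b → constLab p ≡ just b → i < ar b → ∃[ c ] (constLab (p ∷ʳ i) ≡ just c)
      arity-in [] i b refl lt with i <? ar a
      ... | yes _ = a , refl
      ... | no ¬l = ⊥-elim (¬l lt)
      arity-in (j ∷ p) i b e lt with j <? ar a
      ... | yes _ = arity-in p i b e lt
      arity-in (j ∷ p) i b () lt | no _

      arity-out : ∀ p i b → constLab p ≡ just b → ar b ≤ i → constLab (p ∷ʳ i) ≡ nothing
      arity-out [] i b refl ge with i <? ar a
      ... | yes lt = ⊥-elim (≤⇒≯ ge lt)
      ... | no _   = refl
      arity-out (j ∷ p) i b e ge with j <? ar a
      ... | yes _ = arity-out p i b e ge
      ... | no _  = refl

    constTm : Tm A ar
    constTm = record
      { lab  = constLab
      ; tree = record { root-def = a , refl ; closed = closed ; arity-in = arity-in ; arity-out = arity-out }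
      }

  cauchy⇒limit : (ts : ℕ → Tm A ar) → Cauchy (lab ∘ ts) → ∃[ t ] Lim (lab ∘ ts) (lab t)
  cauchy⇒limit ts cauchy = record { lab = L ; tree = L-tree } , converges
    where
    -- A running maximum, so that the term fixing L at p ∷ʳ i also fixes L at p.
    modulus : ℕ → ℕ
    modulus zero    = proj₁ (cauchy zero)
    modulus (suc k) = proj₁ (cauchy (suc k)) ⊔ modulus k

    modulus-mono : ∀ {m k} → m ≤′ k → modulus m ≤ modulus k
    modulus-mono (≤′-reflexive refl) = ≤-refl
    modulus-mono (≤′-step m≤k)       = ≤-trans (modulus-mono m≤k) (m≤n⊔m _ _)

    consecutive : ∀ k j → modulus k < j → DistLt k (lab (ts j)) (lab (ts (suc j)))
    consecutive k j lt = proj₂ (cauchy k) j (≤-<-trans (bound k) lt)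
      where
      bound : ∀ k → proj₁ (cauchy k) ≤ modulus k
      bound zero    = ≤-refl
      bound (suc k) = m≤m⊔n _ _

    stable : ∀ k i j → modulus k < i → i ≤′ j → DistLt k (lab (ts i)) (lab (ts j))
    stable k i i       lt (≤′-reflexive refl) = DistLt-refl
    stable k i (suc j) lt (≤′-step i≤j)       =
      DistLt-trans (stable k i j lt i≤j) (consecutive k j (<-≤-trans lt (≤′⇒≤ i≤j)))

    L : RTm A
    L p = lab (ts (suc (modulus (length p)))) p

    agree : ∀ p j → modulus (length p) < j → lab (ts j) p ≡ L p
    agree p j lt = sym (stable (length p) _ j ≤-refl (≤⇒≤′ lt) p ≤-refl)

    agree-child : ∀ p i → lab (ts (suc (modulus (length (p ∷ʳ i))))) p ≡ L p
    agree-child p i = agree p _ (s≤s (modulus-mono (≤⇒≤′ (length-≤-++ p (i ∷ [])))))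

    L-tree : IsTree ar L
    L-tree = record
      { root-def  = IsTree.root-def (tree (ts (suc (modulus 0))))
      ; closed    = λ p i e → IsTree.closed (tree (ts _)) p i (trans (agree-child p i) e)
      ; arity-in  = λ p i a e → IsTree.arity-in (tree (ts _)) p i a (trans (agree-child p i) e)
      ; arity-out = λ p i a e → IsTree.arity-out (tree (ts _)) p i a (trans (agree-child p i) e)
      }

    converges : Lim (lab ∘ ts) L
    converges k = suc (modulus k) , λ i le p lp →
      agree p i (≤-trans (s≤s (modulus-mono (≤⇒≤′ lp))) le)

module _ (S : Signature) where
  open Signature S

  occurs? : ∀ {n} (x : Fin n) (r : FTerm S n) → Dec (Occurs S x r)
  occurs? x (var y) with x Fin.≟ y
  ... | yes refl = yes here
  ... | no x≢y   = no λ { here → x≢y refl }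
  occurs? x (fun f ts) with any? (λ j → occurs? x (ts j))
  ... | yes (j , o) = yes (under j o)
  ... | no ¬o       = no λ { (under j o) → ¬o (j , o) }

  module _ {n : ℕ} (σ : Fin n → STm S) where

    private
      I : FTerm S n → RTm Sym
      I r = inst S (λ g → g) r (lab ∘ σ)

      root-def : ∀ r → ∃[ a ] (I r [] ≡ just a)
      root-def (var k)    = IsTree.root-def (tree (σ k))
      root-def (fun f ts) = f , refl

      closed : ∀ r p i → I r p ≡ nothing → I r (p ∷ʳ i) ≡ nothing
      closed (var k)    = IsTree.closed (tree (σ k))
      closed (fun f ts) (j ∷ p) i e with idx (ar f) j
      ... | just j′  = closed (ts j′) p i e
      ... | nothing = refl

      arity-in : ∀ r p i a → I r p ≡ just a → i < ar a → ∃[ b ] (I r (p ∷ʳ i) ≡ just b)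
      arity-in (var k) = IsTree.arity-in (tree (σ k))
      arity-in (fun f ts) [] i a refl lt with idx (ar f) i | idx-< {ar f} {i} lt
      ... | just j′  | _ = root-def (ts j′)
      ... | nothing | ()
      arity-in (fun f ts) (j ∷ p) i a e lt with idx (ar f) j
      ... | just j′  = arity-in (ts j′) p i a e lt
      arity-in (fun f ts) (j ∷ p) i a () lt | nothing

      arity-out : ∀ r p i a → I r p ≡ just a → ar a ≤ i → I r (p ∷ʳ i) ≡ nothing
      arity-out (var k) = IsTree.arity-out (tree (σ k))
      arity-out (fun f ts) [] i a refl ge with idx (ar f) i | idx-≥ {ar f} {i} ge
      ... | nothing | _ = refl
      arity-out (fun f ts) (j ∷ p) i a e ge with idx (ar f) j
      ... | just j′  = arity-out (ts j′) p i a e ge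
      ... | nothing = refl

    instTm : FTerm S n → STm S
    instTm r = record
      { lab  = I r
      ; tree = record { root-def = root-def r ; closed = closed r ; arity-in = arity-in r ; arity-out = arity-out r }
      }

  module _ {A : Set} (e : Sym → A) (f : Sym) where

    mkS≈inst : (ts : Fin (ar f) → RTm A) → mkS S e f ts ≈ inst S e (fun f var) ts
    mkS≈inst ts []      = refl
    mkS≈inst ts (i ∷ p) with idx (ar f) i
    ... | just _  = refl
    ... | nothing = refl

    mkS-DistLt-zero : (ts us : Fin (ar f) → RTm A) → DistLt 0 (mkS S e f ts) (mkS S e f us)
    mkS-DistLt-zero ts us [] _ = refl

    mkS-DistLt-suc : ∀ {n} (ts us : Fin (ar f) → RTm A)
                   → (∀ j → DistLt n (ts j) (us j)) → DistLt (suc n) (mkS S e f ts) (mkS S e f us)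
    mkS-DistLt-suc ts us ts≈us []      _        = refl
    mkS-DistLt-suc ts us ts≈us (i ∷ p) (s≤s lp) with idx (ar f) i
    ... | just j  = ts≈us j p lp
    ... | nothing = refl

module _ (S : Signature) (T : TRS S) where
  open Signature S
  open TRS T

  RuleFreeUpTo : ℕ → RTm (Lab S T) → Set
  RuleFreeUpTo n t = ∀ p → length p ≤ n → ∀ μ → ¬ (t p ≡ just (inj₂ μ))

  RuleFreeUpTo-resp : ∀ {n t u} → DistLt n t u → RuleFreeUpTo n t → RuleFreeUpTo n u
  RuleFreeUpTo-resp t≈u free p lp μ up = free p lp μ (trans (t≈u p lp) up)

  ruleFree⇒SC-DistLt : ∀ {n k t u} → RuleFreeUpTo n t → SC S T k t u → DistLt n t u
  ruleFree⇒SC-DistLt free (nil t≈u) = ≈⇒DistLt t≈u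
  ruleFree⇒SC-DistLt {n} {t = t} free (step p _ (μ , tp , u≈)) q lq with length p ≤? n
  ... | yes lp = ⊥-elim (free p lp μ tp)
  ... | no np  = sym (trans (u≈ q) (replace-above t p _ q (≤-<-trans lq (≰⇒> np))))
  ruleFree⇒SC-DistLt free (cat t↠u u↠v) =
    DistLt-trans t≈u (ruleFree⇒SC-DistLt (RuleFreeUpTo-resp t≈u free) u↠v)
    where t≈u = ruleFree⇒SC-DistLt free t↠u
  ruleFree⇒SC-DistLt {n} free (lim ts _ _ steps _ ts→u) with ts→u n
  ... | N , close = DistLt-trans (prefix N) (close N ≤-refl)
    where
    prefix : ∀ i → DistLt n (ts 0) (ts i)
    prefix zero    = DistLt-refl
    prefix (suc i) = DistLt-trans (prefix i) (ruleFree⇒SC-DistLt (RuleFreeUpTo-resp (prefix i) free) (steps i))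

  msrc-DistLt : ∀ {n} (ψ : MTm S T) (t : STm S) → RuleFreeUpTo n (lab ψ)
              → DistLt n (lab ψ) (emb S T (lab t)) → DistLt n (msrc S T ψ) (lab t)
  msrc-DistLt {n} ψ t free ψ≈t p lp = srcAt-at [] p lp
    where
    srcAt-at : ∀ q p → length (q ++ p) ≤ n → srcAt S T (lab ψ) (at q) p ≡ lab t (q ++ p)
    srcAt-at q p lqp with lab ψ q in ψq | ψ≈t q (≤-trans (length-≤-++ q p) lqp)
    ... | nothing       | tq = sym (closed-++ (tree t) q p (map-injective inj₁-injective (sym tq)))
    ... | just (inj₂ μ) | _  = ⊥-elim (free q (≤-trans (length-≤-++ q p) lqp) μ ψq)
    ... | just (inj₁ f) | tq = below p lqp
      where
      below : ∀ p → length (q ++ p) ≤ n → srcLab S T (lab ψ) (just (inj₁ f)) q p ≡ lab t (q ++ p)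
      below []      _   = trans (map-injective inj₁-injective tq) (cong (lab t) (sym (++-identityʳ q)))
      below (i ∷ p) lqp = trans (srcAt-at (q ∷ʳ i) p (subst (λ r → length r ≤ n) (sym (++-assoc q (i ∷ []) p)) lqp))
                                (cong (lab t) (++-assoc q (i ∷ []) p))

  src-DistLt-tgt : ∀ ψ → WF S T ψ → ∀ n t → Tgt S T ψ t → MindGt S T n ψ → DistLt n (src S T ψ) (lab t)
  src-DistLt-tgt (msP ψ) _ n t (u , ψ↠u , u≈t) free =
    msrc-DistLt ψ t free (DistLt-trans (ruleFree⇒SC-DistLt free ψ↠u) (≈⇒DistLt u≈t))
  src-DistLt-tgt (icat ψs) wf n t (ts , tgt , ts→t) mind with ts→t n
  ... | N , close = begin
      src S T (ψs 0) ≈⟨ srcs-close N ⟩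
      src S T (ψs N) ≈⟨ src-DistLt-tgt (ψs N) (proj₁ (wf N)) n (ts N) (tgt N) (mind N) ⟩
      lab (ts N)     ≈⟨ close N ≤-refl ⟩
      lab t          ∎
    where
    open DistLt-Reasoning n
    srcs-close : ∀ i → DistLt n (src S T (ψs 0)) (src S T (ψs i))
    srcs-close zero = DistLt-refl
    srcs-close (suc i) with wf i
    ... | wfᵢ , _ , tᵢ , tgtᵢ , tᵢ≈src = begin
      src S T (ψs 0)       ≈⟨ srcs-close i ⟩
      src S T (ψs i)       ≈⟨ src-DistLt-tgt (ψs i) wfᵢ n tᵢ tgtᵢ (mind i) ⟩
      lab tᵢ               ≈⟨ ≈⇒DistLt tᵢ≈src ⟩
      src S T (ψs (suc i)) ∎
  src-DistLt-tgt (ψ₁ · ψ₂) (wf₁ , wf₂ , _ , t₁ , tgt₁ , t₁≈src) n t tgt (mind₁ , mind₂) = begin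
      src S T ψ₁ ≈⟨ src-DistLt-tgt ψ₁ wf₁ n t₁ tgt₁ mind₁ ⟩
      lab t₁     ≈⟨ ≈⇒DistLt t₁≈src ⟩
      src S T ψ₂ ≈⟨ src-DistLt-tgt ψ₂ wf₂ n t tgt mind₂ ⟩
      lab t      ∎
    where open DistLt-Reasoning n
  src-DistLt-tgt (fnP f ψs) (wf , _) n t (ts , tgt , t≈) mind =
    DistLt-trans (args-close n mind) (DistLt-sym (≈⇒DistLt t≈))
    where
    args-close : ∀ n → MindGt S T n (fnP f ψs) → DistLt n (src S T (fnP f ψs)) (mkS S (λ g → g) f (lab ∘ ts))
    args-close zero    _    = mkS-DistLt-zero S (λ g → g) f _ _
    args-close (suc n) mind = mkS-DistLt-suc S (λ g → g) f _ _ λ j → src-DistLt-tgt (ψs j) (wf j) n (ts j) (tgt j) (mind j)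
  src-DistLt-tgt (rlP μ ψs) _ n t _ ()

  tgt-defined : ∀ ψ → WF S T ψ → Conv S T ψ → ∃[ t ] Tgt S T ψ t
  tgt-defined (msP ψ) _ conv = conv
  tgt-defined (icat ψs) wf conv = proj₁ limit , ts , tgt , proj₂ limit
    where
    next : ∀ i → ∃[ t ] (Tgt S T (ψs i) t × lab t ≈ src S T (ψs (suc i)))
    next i = proj₂ (proj₂ (wf i))
    ts : ℕ → STm S
    ts = proj₁ ∘ next
    tgt : ∀ i → Tgt S T (ψs i) (ts i)
    tgt = proj₁ ∘ proj₂ ∘ next
    cauchy : Cauchy (lab ∘ ts)
    cauchy k = proj₁ (conv k) , λ j N<j →
      DistLt-trans (≈⇒DistLt (proj₂ (proj₂ (next j))))
        (src-DistLt-tgt (ψs (suc j)) (proj₁ (wf (suc j))) k (ts (suc j)) (tgt (suc j)) (proj₂ (conv k) (suc j) (m<n⇒m<1+n N<j)))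
    limit : ∃[ t ] Lim (lab ∘ ts) (lab t)
    limit = cauchy⇒limit ts cauchy
  tgt-defined (ψ₁ · ψ₂) (_ , wf₂ , _) conv = tgt-defined ψ₂ wf₂ conv
  tgt-defined (fnP f ψs) (wf , _) conv =
    instTm S ts (fun f var) , ts , proj₂ ∘ tgtᵢ , λ p → sym (mkS≈inst S (λ g → g) f (lab ∘ ts) p)
    where
    tgtᵢ : ∀ j → ∃[ t ] Tgt S T (ψs j) t
    tgtᵢ j = tgt-defined (ψs j) (wf j) (conv j)
    ts : Fin (ar f) → STm S
    ts = proj₁ ∘ tgtᵢ
  tgt-defined (rlP μ ψs) (wf , _) conv = instTm S ts rhs , ts , ts-tgt , λ _ → refl
    where
    rhs : FTerm S (Rule.arity (rule μ))
    rhs = Rule.rhs (rule μ)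
    -- Arguments erased by the rule get an arbitrary target.
    pick : ∀ j → Dec (Occurs S j rhs) → ∃[ t ] (Occurs S j rhs → Tgt S T (ψs j) t)
    pick j (yes o) = map₂ const (tgt-defined (ψs j) (wf j) (conv j o))
    pick j (no ¬o) = constTm (Rule.lsym (rule μ)) , λ o → ⊥-elim (¬o o)
    ts : Fin (Rule.arity (rule μ)) → STm S
    ts j = proj₁ (pick j (occurs? S j rhs))
    ts-tgt : ∀ j → Occurs S j rhs → Tgt S T (ψs j) (ts j)
    ts-tgt j = proj₂ (pick j (occurs? S j rhs))

mainTheorem9 : (S : Signature) (T : TRS S) (ψ : PT S T)
    → WF S T ψ → Conv S T ψ
    → (∃[ t ] Tgt S T ψ t)
      × (∀ (n : ℕ) (t : STm S) → Tgt S T ψ t → MindGt S T n ψ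
         → DistLt n (src S T ψ) (lab t))
mainTheorem9 S T ψ wf conv =
  tgt-defined S T ψ wf conv , λ n t tgt mind → src-DistLt-tgt S T ψ wf n t tgt mind
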